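{- Let $G$ be a simple, connected and finite graph of order $n$. Then \[\alpha''(G) \leq n + \left\lfloor \frac{\alpha(G)-n + 2\alpha'(G)}{2} \right\rfloor - \alpha'(G).\]
   Context: Two vertices are adjacent if they are joined by an edge; two edges are adjacent if they share an end vertex; a vertex and an edge are adjacent if the vertex is an end vertex of the edge. $\alpha(G)$ is the maximum size of a set of pairwise non-adjacent vertices (independence number). $\alpha'(G)$ is the maximum size of a set of pairwise non-adjacent edges (edge independence number, i.e. matching number). A total independent set is a subset of $V(G)\cup E(G)$ whose elements are pairwise non-adjacent, and $\alpha''(G)$ (the total independence number) is the maximum size of a total independent set. -}

module Defs where

open import Data.Nat using (ℕ; zero; suc; _+_; _≤_; _<_)
open import Data.Fin using (Fin; toℕ)
open import Data.Fin.Subset using (Subset; _∈_; ∣_∣)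
open import Data.Product using (_×_; _,_)
open import Data.Sum using (_⊎_)
open import Data.List using (List; length)
open import Data.List.Relation.Unary.All using (All)
open import Data.List.Relation.Unary.AllPairs using (AllPairs)
open import Relation.Nullary using (¬_)
open import Relation.Binary.PropositionalEquality using (_≡_)

record Graph (n : ℕ) : Set₁ where
  field
    Adj     : Fin n → Fin n → Set
    sym     : ∀ {u v} → Adj u v → Adj v u
    irrefl  : ∀ {u} → ¬ Adj u u
open Graph public

Edge : ℕ → Set
Edge n = Fin n × Fin n

module _ {n : ℕ} (G : Graph n) where

  data Walk : Fin n → Fin n → Set where
    here : ∀ {u} → Walk u u
    step : ∀ {u w v} → Adj G u w → Walk w v → Walk u v

  Connected : Set
  Connected = ∀ u v → Walk u v

  -- an edge {u,v} is represented (uniquely) by the pair (u , v) with u < v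
  IsEdge : Edge n → Set
  IsEdge (u , v) = (toℕ u < toℕ v) × Adj G u v

  Incident : Fin n → Edge n → Set
  Incident x (u , v) = (x ≡ u) ⊎ (x ≡ v)

  EdgesNonAdj : Edge n → Edge n → Set
  EdgesNonAdj e f = ∀ x → Incident x e → ¬ Incident x f

  IsIndependent : Subset n → Set
  IsIndependent S = ∀ u v → u ∈ S → v ∈ S → ¬ Adj G u v

  -- a set of pairwise non-adjacent edges (matching), given as a list of
  -- edges, pairwise non-adjacent (which also forces the list to be duplicate-free)
  IsMatching : List (Edge n) → Set
  IsMatching M = All IsEdge M × AllPairs EdgesNonAdj M

  IsTotalIndependent : Subset n → List (Edge n) → Set
  IsTotalIndependent S M =
    IsIndependent S × IsMatching M × (∀ x → x ∈ S → All (λ e → ¬ Incident x e) M)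

  IsIndependenceNumber : ℕ → Set
  IsIndependenceNumber k =
    (Σ' (Subset n) (λ S → IsIndependent S × ∣ S ∣ ≡ k))
    × (∀ S → IsIndependent S → ∣ S ∣ ≤ k)
    where open import Data.Product using () renaming (Σ to Σ')

  IsMatchingNumber : ℕ → Set
  IsMatchingNumber k =
    (Σ' (List (Edge n)) (λ M → IsMatching M × length M ≡ k))
    × (∀ M → IsMatching M → length M ≤ k)
    where open import Data.Product using () renaming (Σ to Σ')

  IsTotalIndependenceNumber : ℕ → Set
  IsTotalIndependenceNumber k =
    (Σ' (Subset n) (λ S → Σ' (List (Edge n)) (λ M →
        IsTotalIndependent S M × ∣ S ∣ + length M ≡ k)))
    × (∀ S M → IsTotalIndependent S M → ∣ S ∣ + length M ≤ k)
    where open import Data.Product using () renaming (Σ to Σ')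

{-# OPTIONS --safe #-}
-- A total independent set (S , M) uses ∣ S ∣ + 2 ∣ M ∣ distinct vertices, so
-- ∣ S ∣ + 2 ∣ M ∣ ≤ n; together with ∣ S ∣ ≤ α(G) this gives
-- 2 (∣ S ∣ + ∣ M ∣) ≤ n + α(G), i.e. α''(G) ≤ ⌊(n + α(G)) / 2⌋, which is the
-- right-hand side of the theorem once the α'(G) terms cancel.
module Submission where

open import Defs
open import Data.Nat using (ℕ)
open import Data.Integer using (ℤ; +_; _+_; _-_; _*_; _≤_; _/ℕ_)

import Data.Nat as ℕ
import Data.Nat.Properties as ℕ
import Data.Nat.Tactic.RingSolver as ℕ-Solver
import Data.Integer as ℤ
import Data.Integer.Properties as ℤ
open import Data.Integer.DivMod using (n<s[n/ℕd]*d)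
open import Data.Integer.Tactic.RingSolver using (solve-∀)
open import Data.Fin using (Fin)
open import Data.Fin.Subset using (Subset; _∈_; _∉_; _∪_; ⁅_⁆; ∣_∣)
open import Data.Fin.Subset.Properties
  using (∣p∣≤n; p⊆p∪q; x∈p∪q⁺; x∈p∪q⁻; x∈⁅x⁆; x∈⁅y⁆⇒x≡y; p⊂q⇒∣p∣<∣q∣)
open import Data.Product using (_,_)
open import Data.Sum using (_⊎_; inj₁; inj₂)
import Data.Sum as Sum
open import Data.List using (List; []; _∷_; length)
open import Data.List.Relation.Unary.All using (All; _∷_)
import Data.List.Relation.Unary.All as All
open import Data.List.Relation.Unary.AllPairs using (AllPairs; _∷_)
open import Relation.Binary.PropositionalEquality using (_≡_; _≢_; refl; cong)
open import Relation.Nullary using (¬_)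

∣p∣<∣p∪⁅x⁆∣ : ∀ {n} {x : Fin n} (p : Subset n) → x ∉ p → ∣ p ∣ ℕ.< ∣ p ∪ ⁅ x ⁆ ∣
∣p∣<∣p∪⁅x⁆∣ {x = x} p x∉p =
  p⊂q⇒∣p∣<∣q∣ (p⊆p∪q ⁅ x ⁆ , x , x∈p∪q⁺ (inj₂ (x∈⁅x⁆ x)) , x∉p)

x∈p∪⁅y⁆⁻ : ∀ {n} {x y : Fin n} (p : Subset n) → x ∈ p ∪ ⁅ y ⁆ → x ∈ p ⊎ x ≡ y
x∈p∪⁅y⁆⁻ {y = y} p x∈ = Sum.map₂ (x∈⁅y⁆⇒x≡y y) (x∈p∪q⁻ p ⁅ y ⁆ x∈)

module _ {n : ℕ} (G : Graph n) where

  ∣S∣+2∣M∣≤n : (S : Subset n) (M : List (Edge n)) →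
    All (λ { (u , v) → u ≢ v }) M → AllPairs (EdgesNonAdj G) M →
    (∀ x → x ∈ S → All (λ e → ¬ Incident G x e) M) →
    ∣ S ∣ ℕ.+ 2 ℕ.* length M ℕ.≤ n
  ∣S∣+2∣M∣≤n S [] _ _ _ = ℕ.≤-trans (ℕ.≤-reflexive (ℕ.+-identityʳ ∣ S ∣)) (∣p∣≤n S)
  ∣S∣+2∣M∣≤n S ((u , v) ∷ M) (u≢v ∷ distinct) (uv-disjoint ∷ disjoint) S-avoids =
    begin
      ∣ S ∣ ℕ.+ 2 ℕ.* length ((u , v) ∷ M) ≡⟨ shift ∣ S ∣ (length M) ⟩
      2 ℕ.+ ∣ S ∣ ℕ.+ 2 ℕ.* length M
        ≤⟨ ℕ.+-monoˡ-≤ (2 ℕ.* length M) (ℕ.≤-trans (ℕ.s≤s ∣S∣<∣S₁∣) ∣S₁∣<∣S₂∣) ⟩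
      ∣ S₂ ∣ ℕ.+ 2 ℕ.* length M
        ≤⟨ ∣S∣+2∣M∣≤n S₂ M distinct disjoint S₂-avoids ⟩
      n ∎
    where
    open ℕ.≤-Reasoning
    shift : ∀ s m → s ℕ.+ 2 ℕ.* ℕ.suc m ≡ 2 ℕ.+ s ℕ.+ 2 ℕ.* m
    shift = ℕ-Solver.solve-∀
    S₁ S₂ : Subset n
    S₁ = S ∪ ⁅ u ⁆
    S₂ = S₁ ∪ ⁅ v ⁆

    ∣S∣<∣S₁∣ : ∣ S ∣ ℕ.< ∣ S₁ ∣
    ∣S∣<∣S₁∣ = ∣p∣<∣p∪⁅x⁆∣ S (λ u∈S → All.head (S-avoids u u∈S) (inj₁ refl))

    v∉S₁ : v ∉ S₁
    v∉S₁ v∈S₁ with x∈p∪⁅y⁆⁻ S v∈S₁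
    ... | inj₁ v∈S = All.head (S-avoids v v∈S) (inj₂ refl)
    ... | inj₂ refl = u≢v refl

    ∣S₁∣<∣S₂∣ : ∣ S₁ ∣ ℕ.< ∣ S₂ ∣
    ∣S₁∣<∣S₂∣ = ∣p∣<∣p∪⁅x⁆∣ S₁ v∉S₁

    S₂-avoids : ∀ x → x ∈ S₂ → All (λ f → ¬ Incident G x f) M
    S₂-avoids x x∈S₂ with x∈p∪⁅y⁆⁻ S₁ x∈S₂
    ... | inj₂ refl = All.map (λ e#f → e#f v (inj₂ refl)) uv-disjoint
    ... | inj₁ x∈S₁ with x∈p∪⁅y⁆⁻ S x∈S₁
    ... | inj₂ refl = All.map (λ e#f → e#f u (inj₁ refl)) uv-disjoint
    ... | inj₁ x∈S = All.tail (S-avoids x x∈S)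

  2*[∣S∣+∣M∣]≤n+α : ∀ {α S M} → (∀ T → IsIndependent G T → ∣ T ∣ ℕ.≤ α) →
    IsTotalIndependent G S M → 2 ℕ.* (∣ S ∣ ℕ.+ length M) ℕ.≤ n ℕ.+ α
  2*[∣S∣+∣M∣]≤n+α {α} {S} {M} α-max (S-indep , (M-edges , M-disjoint) , S-avoids) =
    begin
      2 ℕ.* (∣ S ∣ ℕ.+ length M)          ≡⟨ regroup ∣ S ∣ (length M) ⟩
      (∣ S ∣ ℕ.+ 2 ℕ.* length M) ℕ.+ ∣ S ∣
        ≤⟨ ℕ.+-mono-≤ (∣S∣+2∣M∣≤n S M distinct M-disjoint S-avoids) (α-max S S-indep) ⟩
      n ℕ.+ α ∎
    where
    open ℕ.≤-Reasoning
    regroup : ∀ s m → 2 ℕ.* (s ℕ.+ m) ≡ (s ℕ.+ 2 ℕ.* m) ℕ.+ s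
    regroup = ℕ-Solver.solve-∀
    distinct : All (λ { (u , v) → u ≢ v }) M
    distinct = All.map (λ { (u<v , _) refl → ℕ.<-irrefl refl u<v }) M-edges

≤-/ℕ : ∀ (x y : ℤ) d .{{_ : ℕ.NonZero d}} → y * + d ≤ x → y ≤ x /ℕ d
≤-/ℕ x y d yd≤x = ℤ.≮⇒≥ λ x/d<y → ℤ.<-irrefl refl (begin-strict
  x                        <⟨ n<s[n/ℕd]*d x d ⟩
  ℤ.suc (x /ℕ d) * + d     ≤⟨ ℤ.*-monoʳ-≤-nonNeg (+ d) (ℤ.i<j⇒suc[i]≤j x/d<y) ⟩
  y * + d                  ≤⟨ yd≤x ⟩
  x                        ∎)
  where open ℤ.≤-Reasoning

2*y≤n+a⇒y≤bound : ∀ (n a a′ y : ℕ) → 2 ℕ.* y ℕ.≤ n ℕ.+ a →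
  + y ≤ + n + ((+ a - + n + + 2 * + a′) /ℕ 2) - + a′
2*y≤n+a⇒y≤bound n a a′ y 2y≤n+a = begin
  + y                               ≡⟨ split (+ y) (+ n) (+ a′) ⟩
  (+ y + + a′ - + n) + (+ n - + a′)
    ≤⟨ ℤ.+-monoˡ-≤ (+ n - + a′) (≤-/ℕ x (+ y + + a′ - + n) 2 doubled≤x) ⟩
  x /ℕ 2 + (+ n - + a′)             ≡⟨ reorder (x /ℕ 2) (+ n) (+ a′) ⟩
  + n + x /ℕ 2 - + a′               ∎
  where
  open ℤ.≤-Reasoning
  x c : ℤ
  x = + a - + n + + 2 * + a′
  c = + 2 * + a′ - + 2 * + n

  split : ∀ y n a′ → y ≡ (y + a′ - n) + (n - a′)
  split = solve-∀
  reorder : ∀ q n a′ → q + (n - a′) ≡ n + q - a′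
  reorder = solve-∀
  double : ∀ y n a′ → (y + a′ - n) * + 2 ≡ + 2 * y + (+ 2 * a′ - + 2 * n)
  double = solve-∀
  undouble : ∀ n a a′ → (n + a) + (+ 2 * a′ - + 2 * n) ≡ a - n + + 2 * a′
  undouble = solve-∀

  doubled≤x : (+ y + + a′ - + n) * + 2 ≤ x
  doubled≤x = begin
    (+ y + + a′ - + n) * + 2 ≡⟨ double (+ y) (+ n) (+ a′) ⟩
    + 2 * + y + c            ≡⟨ cong (_+ c) (ℤ.pos-* 2 y) ⟨
    + (2 ℕ.* y) + c          ≤⟨ ℤ.+-monoˡ-≤ c (ℤ.+≤+ 2y≤n+a) ⟩
    + (n ℕ.+ a) + c          ≡⟨ cong (_+ c) (ℤ.pos-+ n a) ⟩
    (+ n + + a) + c          ≡⟨ undouble (+ n) (+ a) (+ a′) ⟩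
    x                        ∎

mainTheorem1 : (n : ℕ) (G : Graph n) → Connected G →
    (a a′ a″ : ℕ) →
    IsIndependenceNumber G a → IsMatchingNumber G a′ → IsTotalIndependenceNumber G a″ →
    + a″ ≤ + n + ((+ a - + n + + 2 * + a′) /ℕ 2) - + a′
mainTheorem1 n G _ a a′ _ (_ , α-max) _ ((_ , _ , total-indep , refl) , _) =
  2*y≤n+a⇒y≤bound n a a′ _ (2*[∣S∣+∣M∣]≤n+α G α-max total-indep)
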